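{- For all $G,H\subseteq A$ and every formula $\varphi\in\mathcal{L}_{CoRGAL}$, the formula $\langle[G]\rangle\varphi\to\langle[G\cup H]\rangle\varphi$ is valid.
   Context: Fix a finite set $A$ of agents and a countable set $P$ of propositional variables. The language $\mathcal{L}_{CoRGAL}$ is given by $\varphi ::= p \mid \neg\varphi \mid (\varphi\wedge\varphi) \mid K_a\varphi \mid [\varphi]\varphi \mid [G,\varphi]\varphi \mid [\langle G\rangle]\varphi$ with $p\in P$, $a\in A$, $G\subseteq A$; $\langle\varphi\rangle\psi:=\neg[\varphi]\neg\psi$, $\langle[G]\rangle\varphi:=\neg[\langle G\rangle]\neg\varphi$. $\mathcal{L}_{EL}$ is the fragment built only from $p,\neg,\wedge,K_a$. For $G\subseteq A$, $\mathcal{L}_{EL}^G$ is the set of formulas $\bigwedge_{i\in G}K_i\varphi_i$ with each $\varphi_i\in\mathcal{L}_{EL}$; $\psi_G$ denotes an element of $\mathcal{L}_{EL}^G$, $\chi_{A\setminus G}$ one of $\mathcal{L}_{EL}^{A\setminus G}$. An epistemic model is $M=(W,\sim,V)$ with $W\neq\emptyset$, each $\sim_a$ an equivalence relation, $V:P\to\mathcal{P}(W)$. $M^\varphi$ is the restriction of $M$ to the states where $\varphi$ holds. Semantics: $p,\neg,\wedge$ as usual; $K_a\varphi$ true at $w$ iff $\varphi$ true at all $v\sim_a w$; $(M,w)\models[\varphi]\psi$ iff $(M,w)\models\varphi$ implies $(M^\varphi,w)\models\psi$; $(M,w)\models[G,\chi]\varphi$ iff $(M,w)\models\chi$ and for all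 $\psi_G$, $(M,w)\models[\psi_G\wedge\chi]\varphi$; $(M,w)\models[\langle G\rangle]\varphi$ iff for all $\psi_G$ there is $\chi_{A\setminus G}$ with $(M,w)\models\psi_G\to\langle\psi_G\wedge\chi_{A\setminus G}\rangle\varphi$. Equivalently, $(M,w)\models\langle[G]\rangle\varphi$ iff there is $\psi_G$ such that for all $\chi_{A\setminus G}$, $(M,w)\models\psi_G\wedge[\psi_G\wedge\chi_{A\setminus G}]\varphi$. Valid means true at every pointed model. -}

module Defs where

open import Data.Nat using (ℕ)
open import Data.Fin using (Fin)
open import Data.Fin.Subset using (Subset; _∈_; ∁; _∪_)
open import Data.Product using (Σ; _×_; _,_; proj₁; proj₂)
open import Data.Empty using (⊥)
open import Relation.Nullary using (¬_)
open import Relation.Binary.Structures using (IsEquivalence)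

-- Agents: A = Fin n (finite).  Propositional variables: P = ℕ (countable).
-- Coalitions G ⊆ A: Subset n.

data EL (n : ℕ) : Set where
  atom : ℕ → EL n
  neg  : EL n → EL n
  conj : EL n → EL n → EL n
  K    : Fin n → EL n → EL n

data Form (n : ℕ) : Set where
  atom  : ℕ → Form n
  neg   : Form n → Form n
  conj  : Form n → Form n → Form n
  K     : Fin n → Form n → Form n
  ann   : Form n → Form n → Form n
  grp   : Subset n → Form n → Form n → Form n
  coal  : Subset n → Form n → Form n

_⇒_ : ∀ {n} → Form n → Form n → Form n
φ ⇒ ψ = neg (conj φ (neg ψ))

dia : ∀ {n} → Form n → Form n → Form n
dia φ ψ = neg (ann φ (neg ψ))

coalDia : ∀ {n} → Subset n → Form n → Form n
coalDia G φ = neg (coal G (neg φ))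

-- Epistemic models (nonemptiness of W is automatic for pointed models)
record Model (n : ℕ) : Set₁ where
  field
    W     : Set
    R     : Fin n → W → W → Set
    equiv : ∀ a → IsEquivalence (R a)
    V     : ℕ → W → Set

open Model public

restrict : ∀ {n} (M : Model n) → (W M → Set) → Model n
restrict M P = record
  { W = Σ (W M) P
  ; R = λ a u v → R M a (proj₁ u) (proj₁ v)
  ; equiv = λ a → record
      { refl  = IsEquivalence.refl (equiv M a)
      ; sym   = IsEquivalence.sym (equiv M a)
      ; trans = IsEquivalence.trans (equiv M a) }
  ; V = λ p u → V M p (proj₁ u)
  }

satEL : ∀ {n} (M : Model n) → EL n → W M → Set
satEL M (atom p)   w = V M p w
satEL M (neg φ)    w = ¬ satEL M φ w
satEL M (conj φ ψ) w = satEL M φ w × satEL M ψ w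
satEL M (K a φ)    w = ∀ v → R M a w v → satEL M φ v

-- Semantics of ψ_G = ⋀_{i∈G} K_i (f i)  (the values of f outside G are irrelevant;
-- every element of L_EL^G arises from some f : Fin n → EL n)
ConjK : ∀ {n} (M : Model n) → Subset n → (Fin n → EL n) → W M → Set
ConjK M G f w = ∀ i → i ∈ G → satEL M (K i (f i)) w

sat : ∀ {n} (M : Model n) → Form n → W M → Set
sat M (atom p)   w = V M p w
sat M (neg φ)    w = ¬ sat M φ w
sat M (conj φ ψ) w = sat M φ w × sat M ψ w
sat M (K a φ)    w = ∀ v → R M a w v → sat M φ v
sat M (ann φ ψ)  w = (p : sat M φ w) → sat (restrict M (sat M φ)) ψ (w , p)
sat {n} M (grp G χ φ) w =
  sat M χ w ×
  (∀ (f : Fin n → EL n) →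
     (p : ConjK M G f w × sat M χ w) →
     sat (restrict M (λ v → ConjK M G f v × sat M χ v)) φ (w , p))
-- (M,w) ⊨ [⟨G⟩]φ  iff  for all ψ_G there is χ_{A∖G} with
--   (M,w) ⊨ ψ_G → ⟨ψ_G ∧ χ_{A∖G}⟩φ   (→ and ⟨·⟩ unfolded as ¬(_∧¬_) and ¬[·]¬)
sat {n} M (coal G φ) w =
  ∀ (f : Fin n → EL n) → Σ (Fin n → EL n) λ g →
    ¬ (ConjK M G f w ×
       ¬ ¬ ((p : ConjK M G f w × ConjK M (∁ G) g w) →
            ¬ sat (restrict M (λ v → ConjK M G f v × ConjK M (∁ G) g v)) φ (w , p)))

Valid : ∀ {n} → Form n → Set₁
Valid {n} φ = ∀ (M : Model n) (w : W M) → sat M φ w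

module Submission where

-- Since ⟨[G]⟩φ = ¬[⟨G⟩]¬φ, the proposition is the contrapositive of the
-- antitonicity of [⟨_⟩] in the coalition: if G ⊆ G' then [⟨G'⟩]ψ → [⟨G⟩]ψ.
-- To prove that, answer a G-announcement ψ_G by the G'-announcement that
-- pads ψ_G with trivial conjuncts K_i⊤ on G' ∖ G; the opponents' reply
-- χ_{A∖G'} is in turn padded with K_i⊤ on G' ∖ G to a reply χ_{A∖G}.  Both
-- joint announcements then hold at exactly the same states, so the two
-- updated models are the same model up to a bisimulation.

open import Defs
open import Data.Nat using (ℕ)
open import Data.Fin using (Fin)
open import Data.Fin.Subset using (Subset; _∪_; _⊆_; ∁)
open import Data.Fin.Subset.Properties using (_∈?_; p⊆p∪q; p⊆q⇒∁p⊇∁q)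
open import Data.Product using (Σ; _×_; _,_; proj₁; proj₂)
open import Data.Product.Function.NonDependent.Propositional using (_×-⇔_)
open import Data.Product.Function.Dependent.Propositional using (Σ-⇔)
open import Function.Bundles using (_⇔_; mk⇔; module Equivalence)
open import Function.Construct.Identity using (↠-id)
open import Function.Construct.Symmetry using (⇔-sym)
open import Function.Related.TypeIsomorphisms using (¬-cong-⇔)
open import Relation.Nullary using (yes; no)
open import Relation.Nullary.Negation using (¬¬-map; contradiction)
open import Relation.Binary.PropositionalEquality using (_≡_; refl)

open Equivalence using (to; from)

∀-⇔ : {X : Set} {A B : X → Set} → (∀ x → A x ⇔ B x) → (∀ x → A x) ⇔ (∀ x → B x)
∀-⇔ A⇔B = mk⇔ (λ h x → to (A⇔B x) (h x)) (λ h x → from (A⇔B x) (h x))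

Π-⇔ : {A B : Set} {C : A → Set} {D : B → Set} →
      (A⇔B : A ⇔ B) → (∀ a b → C a ⇔ D b) → ((a : A) → C a) ⇔ ((b : B) → D b)
Π-⇔ A⇔B C⇔D = mk⇔ (λ h b → to (C⇔D _ b) (h (from A⇔B b)))
                  (λ h a → from (C⇔D a _) (h (to A⇔B a)))

record Bisim {n : ℕ} (M N : Model n) : Set₁ where
  field
    Z     : W M → W N → Set
    atoms : ∀ {u v} → Z u v → ∀ p → V M p u ⇔ V N p v
    forth : ∀ {u v} a → Z u v → ∀ u' → R M a u u' → Σ (W N) λ v' → R N a v v' × Z u' v'
    back  : ∀ {u v} a → Z u v → ∀ v' → R N a v v' → Σ (W M) λ u' → R M a u u' × Z u' v'
open Bisim

module _ {n : ℕ} {M N : Model n} (B : Bisim M N) where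

  box-⇔ : {P : W M → Set} {Q : W N → Set} → (∀ {u v} → Z B u v → P u ⇔ Q v) →
          ∀ a {u v} → Z B u v →
          (∀ u' → R M a u u' → P u') ⇔ (∀ v' → R N a v v' → Q v')
  box-⇔ P⇔Q a z = mk⇔
    (λ h v' r → let (u' , r' , z') = back B a z v' r in to (P⇔Q z') (h u' r'))
    (λ h u' r → let (v' , r' , z') = forth B a z u' r in from (P⇔Q z') (h v' r'))

  satEL-⇔ : (φ : EL n) → ∀ {u v} → Z B u v → satEL M φ u ⇔ satEL N φ v
  satEL-⇔ (atom p)   z = atoms B z p
  satEL-⇔ (neg φ)    z = ¬-cong-⇔ (satEL-⇔ φ z)
  satEL-⇔ (conj φ ψ) z = satEL-⇔ φ z ×-⇔ satEL-⇔ ψ z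
  satEL-⇔ (K a φ)    z = box-⇔ (satEL-⇔ φ) a z

  ConjK-⇔ : ∀ G f {u v} → Z B u v → ConjK M G f u ⇔ ConjK N G f v
  ConjK-⇔ G f z = ∀-⇔ λ i → ∀-⇔ λ _ → satEL-⇔ (K i (f i)) z

  restrict-bisim : (P : W M → Set) (Q : W N → Set) → (∀ {u v} → Z B u v → P u ⇔ Q v) →
                   Bisim (restrict M P) (restrict N Q)
  restrict-bisim P Q P⇔Q = record
    { Z     = λ u v → Z B (proj₁ u) (proj₁ v)
    ; atoms = λ z p → atoms B z p
    ; forth = λ a z u' r → let (v' , r' , z') = forth B a z (proj₁ u') r in
                (v' , to (P⇔Q z') (proj₂ u')) , r' , z'
    ; back  = λ a z v' r → let (u' , r' , z') = back B a z (proj₁ v') r in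
                (u' , from (P⇔Q z') (proj₂ v')) , r' , z'
    }

-- For the update
-- modalities the bisimulation is carried over to the updated models by
-- restrict-bisim, using invariance of the announced formula.
sat-⇔ : ∀ {n} {M N : Model n} (B : Bisim M N) (φ : Form n) →
        ∀ {u v} → Z B u v → sat M φ u ⇔ sat N φ v
sat-⇔ B (atom p)    z = atoms B z p
sat-⇔ B (neg φ)     z = ¬-cong-⇔ (sat-⇔ B φ z)
sat-⇔ B (conj φ ψ)  z = sat-⇔ B φ z ×-⇔ sat-⇔ B ψ z
sat-⇔ B (K a φ)     z = box-⇔ B (sat-⇔ B φ) a z
sat-⇔ B (ann φ ψ)   z =
  Π-⇔ (sat-⇔ B φ z) λ _ _ → sat-⇔ (restrict-bisim B _ _ (sat-⇔ B φ)) ψ z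
sat-⇔ {M = M} {N} B (grp G χ φ) z =
  sat-⇔ B χ z ×-⇔ (∀-⇔ λ f →
    Π-⇔ (announced f z) λ _ _ → sat-⇔ (restrict-bisim B _ _ (announced f)) φ z)
  where
  announced : ∀ f {u v} → Z B u v → (ConjK M G f u × sat M χ u) ⇔ (ConjK N G f v × sat N χ v)
  announced f z = ConjK-⇔ B G f z ×-⇔ sat-⇔ B χ z
sat-⇔ {M = M} {N} B (coal G φ) z =
  ∀-⇔ λ f → Σ-⇔ (↠-id _) λ {g} →
    ¬-cong-⇔ (ConjK-⇔ B G f z ×-⇔ ¬-cong-⇔ (¬-cong-⇔ (
      Π-⇔ (announced f g z) λ _ _ →
        ¬-cong-⇔ (sat-⇔ (restrict-bisim B _ _ (announced f g)) φ z))))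
  where
  announced : ∀ f g {u v} → Z B u v →
              (ConjK M G f u × ConjK M (∁ G) g u) ⇔ (ConjK N G f v × ConjK N (∁ G) g v)
  announced f g z = ConjK-⇔ B G f z ×-⇔ ConjK-⇔ B (∁ G) g z

-- Updating a model with pointwise equivalent announcements yields the same
-- truths at every surviving state: the identity on W M is a bisimulation.
restrict-cong : ∀ {n} (M : Model n) {P Q : W M → Set} → (∀ v → P v ⇔ Q v) →
                ∀ φ {w} (p : P w) (q : Q w) →
                sat (restrict M P) φ (w , p) ⇔ sat (restrict M Q) φ (w , q)
restrict-cong M {P} {Q} P⇔Q φ p q = sat-⇔ same φ refl
  where
  same : Bisim (restrict M P) (restrict M Q)
  same = record
    { Z     = λ u v → proj₁ u ≡ proj₁ v
    ; atoms = λ { refl p → mk⇔ (λ x → x) (λ x → x) }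
    ; forth = λ { a refl u' r → (proj₁ u' , to (P⇔Q _) (proj₂ u')) , r , refl }
    ; back  = λ { a refl v' r → (proj₁ v' , from (P⇔Q _) (proj₂ v')) , r , refl }
    }

top : ∀ {n} → EL n
top = neg (conj (atom 0) (neg (atom 0)))

knows-top : ∀ {n} (M : Model n) i w → satEL M (K i top) w
knows-top M i w v r (p₀ , ¬p₀) = ¬p₀ p₀

padTop : ∀ {n} → Subset n → (Fin n → EL n) → Fin n → EL n
padTop S f i with i ∈? S
... | yes _ = f i
... | no  _ = top

ConjK-padTop : ∀ {n} (M : Model n) {S T : Subset n} → S ⊆ T → ∀ f w →
               ConjK M T (padTop S f) w ⇔ ConjK M S f w
ConjK-padTop M {S} {T} S⊆T f w = mk⇔ shrink extend
  where
  shrink : ConjK M T (padTop S f) w → ConjK M S f w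
  shrink h i i∈S with i ∈? S | h i (S⊆T i∈S)
  ... | yes _   | known = known
  ... | no  i∉S | _     = contradiction i∈S i∉S
  extend : ConjK M S f w → ConjK M T (padTop S f) w
  extend h i _ with i ∈? S
  ... | yes i∈S = h i i∈S
  ... | no  _   = knows-top M i w

-- Against ψ_G the opponents use their reply g' to the padded announcement;
-- the joint announcements coincide pointwise ('same'), so the refutation
-- given by [⟨G'⟩]ψ transfers along restrict-cong.
coal-antitone : ∀ {n} (M : Model n) {G G' : Subset n} → G ⊆ G' → ∀ ψ w →
                sat M (coal G' ψ) w → sat M (coal G ψ) w
coal-antitone {n} M {G} {G'} G⊆G' ψ w c f = g , λ (ψG , survives) →
  proj₂ (c (padTop G f)) (from (ConjK-padTop M G⊆G' f w) ψG ,
           ¬¬-map (λ h q s → h (from (same w) q)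
                               (from (restrict-cong M same ψ (from (same w) q) q) s))
                  survives)
  where
  -- the opponents' reply to the padded G'-announcement, padded on G' ∖ G
  g' : Fin n → EL n
  g' = proj₁ (c (padTop G f))
  g : Fin n → EL n
  g = padTop (∁ G') g'
  same : ∀ v → (ConjK M G f v × ConjK M (∁ G) g v) ⇔
               (ConjK M G' (padTop G f) v × ConjK M (∁ G') g' v)
  same v = ⇔-sym (ConjK-padTop M G⊆G' f v) ×-⇔ ConjK-padTop M (p⊆q⇒∁p⊇∁q G⊆G') g' v

proposition4 : ∀ {n : ℕ} (G H : Subset n) (φ : Form n) →
    Valid (coalDia G φ ⇒ coalDia (G ∪ H) φ)
proposition4 G H φ M w (⟨[G]⟩φ , ¬¬[⟨G∪H⟩]¬φ) =
  ¬¬[⟨G∪H⟩]¬φ λ c → ⟨[G]⟩φ (coal-antitone M (p⊆p∪q H) (neg φ) w c)
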